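{- For every $n\ge 1$ and $b\ge 2$, the $n\times n$ matrix $$P(i,j)=\mathbb{P}\{\,jb\le i+X_1+\cdots+X_n\le (j+1)b-1\,\},\qquad 0\le i,j\le n-1,$$ with $X_1,\dots,X_n$ independent and uniform on $\{0,1,\dots,b-1\}$, is totally positive of order two, i.e. all its $2\times 2$ minors are nonnegative.
   Context: $P$ is the transition matrix of the carries Markov chain for adding $n$ random base-$b$ numbers. -}

module Defs where

open import Data.Nat as ℕ using (ℕ; zero; suc; _+_; _*_; _∸_; _^_; _≤?_; NonZero)
open import Data.Nat.Properties using (m^n≢0)
open import Data.Fin using (Fin; toℕ)
open import Data.Vec as Vec using (Vec; []; _∷_)
open import Data.List as List using (List; []; _∷_; allFin; concatMap; map; filter; length)
open import Data.Integer using (+_)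
open import Data.Rational as ℚ using (ℚ; _/_)
open import Relation.Nullary.Decidable using (_×-dec_)

-- All n-tuples (X₁,…,Xₙ) with each Xₖ ∈ {0,…,b-1}, i.e. the sample space
-- of n independent uniform digits (each tuple has probability 1/bⁿ).
allTuples : (n b : ℕ) → List (Vec (Fin b) n)
allTuples zero    b = [] ∷ []
allTuples (suc n) b = concatMap (λ x → map (x ∷_) (allTuples n b)) (allFin b)

digitSum : ∀ {n b} → Vec (Fin b) n → ℕ
digitSum xs = Vec.sum (Vec.map toℕ xs)

carryCount : (n b i j : ℕ) → ℕ
carryCount n b i j =
  length (filter (λ xs → (j * b ≤? i + digitSum xs) ×-dec
                         (i + digitSum xs ≤? (suc j) * b ∸ 1))
                 (allTuples n b))

P : (n b : ℕ) .{{_ : NonZero b}} → Fin n → Fin n → ℚ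
P n b i j = (+ carryCount n b (toℕ i) (toℕ j)) / (b ^ n)
  where instance _ = m^n≢0 b n

-- Put S = X₁ + ⋯ + Xₙ. Then bⁿ P(i, j) = Σ W(i + S, j) over all digit tuples, where
-- W(v, j) = [j b ≤ v < (j + 1) b] is a TP2 0/1 kernel. One more digit replaces W by its block sum
-- Σ_{x<b} W(v + x, j), which is the composition of W with the window kernel [v ≤ w < v + b]. The
-- window kernel is TP2 and compositions of TP2 kernels are TP2 (basic composition formula), so by
-- induction on n the matrix of counts is TP2; dividing by b²ⁿ does not change the sign of a minor.
module Submission where

open import Defs

module Kernels where

  open import Data.Nat.Properties using (+-*-semiring)
  open import Algebra.Properties.Semiring.Sum +-*-semiring
    using (sum; sum-syntax; sum-cong-≗; sum-replicate-zero; ∑-distrib-+; ∑-comm; *-distribˡ-sum; *-distribʳ-sum)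
  open import Data.Empty using (⊥-elim)
  open import Data.Fin as Fin using (Fin; toℕ)
  open import Data.List using (List; []; _∷_; _++_; allFin; length; filter; map; concatMap; tabulate)
  open import Data.List.Properties using (length-++; filter-++)
  open import Data.Nat using (ℕ; zero; suc; _+_; _*_; _∸_; _≤_; _<_; _≤?_; z≤n; s≤s)
  open import Data.Nat.Properties
    using (+-comm; +-assoc; +-identityʳ; *-zeroʳ; +-mono-≤; +-monoˡ-≤; *-monoˡ-≤; m∸n≤m; m≤m+n; m≤n⇒∃[o]m+o≡n;
           ≤-refl; ≤-reflexive; ≤-trans; <-trans; <-≤-trans; <⇒≤; <-irrefl; module ≤-Reasoning)
  open import Data.Nat.Tactic.RingSolver using (solve-∀)
  open import Data.Product using (_,_; _×_)
  open import Data.Sum using (_⊎_; inj₁; inj₂)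
  open import Data.Vec as Vec using ()
  open import Data.Vec.Functional using (Vector)
  open import Function using (_∘_; id)
  open import Relation.Binary.PropositionalEquality
  open import Relation.Nullary using (Dec; yes; no)
  open import Relation.Nullary.Decidable using (_×-dec_)
  open import Relation.Unary using (Pred; Decidable)

  ∑-mono-≤ : ∀ {N} {f g : Vector ℕ N} → (∀ i → f i ≤ g i) → sum f ≤ sum g
  ∑-mono-≤ {zero}  f≤g = z≤n
  ∑-mono-≤ {suc N} f≤g = +-mono-≤ (f≤g _) (∑-mono-≤ (λ i → f≤g (Fin.suc i)))

  x*∑f+∑g*y≡∑[xf+gy] : ∀ {N} x y (f g : Vector ℕ N) →
    x * sum f + sum g * y ≡ ∑[ s < N ] (x * f s + g s * y)
  x*∑f+∑g*y≡∑[xf+gy] x y f g = sym (trans (∑-distrib-+ (λ s → x * f s) (λ s → g s * y))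
    (cong₂ _+_ (sym (*-distribˡ-sum x f)) (sym (*-distribʳ-sum y g))))

  rearrangement-≤ : ∀ {x′ x y′ y} → x′ ≤ x → y′ ≤ y → x′ * y + x * y′ ≤ x′ * y′ + x * y
  rearrangement-≤ {x′} {y′ = y′} x′≤x y′≤y with m≤n⇒∃[o]m+o≡n x′≤x | m≤n⇒∃[o]m+o≡n y′≤y
  ... | δ , refl | ε , refl = begin
    x′ * (y′ + ε) + (x′ + δ) * y′           ≤⟨ m≤m+n _ (δ * ε) ⟩
    x′ * (y′ + ε) + (x′ + δ) * y′ + δ * ε   ≡⟨ expand x′ δ y′ ε ⟩
    x′ * y′ + (x′ + δ) * (y′ + ε)           ∎
    where
    open ≤-Reasoning
    expand : ∀ a d b e → a * (b + e) + (a + d) * b + d * e ≡ a * b + (a + d) * (b + e)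
    expand = solve-∀

  Kernel : Set
  Kernel = ℕ → ℕ → ℕ

  TP2 : Kernel → Set
  TP2 K = ∀ {v₁ v₂ j₁ j₂} → v₁ < v₂ → j₁ < j₂ → K v₁ j₂ * K v₂ j₁ ≤ K v₁ j₁ * K v₂ j₂

  TP2-resp : ∀ {K L : Kernel} → (∀ v j → K v j ≡ L v j) → TP2 K → TP2 L
  TP2-resp {K} {L} K≡L tpK {v₁} {v₂} {j₁} {j₂} v< j< =
    subst₂ _≤_ (cong₂ _*_ (K≡L v₁ j₂) (K≡L v₂ j₁)) (cong₂ _*_ (K≡L v₁ j₁) (K≡L v₂ j₂)) (tpK v< j<)

  compose : ℕ → Kernel → Kernel → Kernel
  compose N K L v j = ∑[ s < N ] (K v (toℕ s) * L (toℕ s) j)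

  minor-cross-term : ∀ {a₁ a₂ c₁ c₂ k₁ k₂ l₁ l₂} → k₁ * a₂ ≤ a₁ * k₂ → c₂ * l₁ ≤ c₁ * l₂ →
    a₁ * c₂ * (k₂ * l₁) + k₁ * l₂ * (a₂ * c₁) ≤ a₁ * c₁ * (k₂ * l₂) + k₁ * l₁ * (a₂ * c₂)
  minor-cross-term {a₁} {a₂} {c₁} {c₂} {k₁} {k₂} {l₁} {l₂} ka≤ak cl≤cl =
    subst₂ _≤_ (reorder a₁ a₂ c₁ c₂ k₁ k₂ l₁ l₂) (reorder a₁ a₂ c₂ c₁ k₁ k₂ l₂ l₁)
      (rearrangement-≤ ka≤ak cl≤cl)
    where
    reorder : ∀ a₁ a₂ c₁ c₂ k₁ k₂ l₁ l₂ →
      k₁ * a₂ * (c₁ * l₂) + a₁ * k₂ * (c₂ * l₁) ≡ a₁ * c₂ * (k₂ * l₁) + k₁ * l₂ * (a₂ * c₁)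
    reorder = solve-∀

  TP2-compose : ∀ N {K L} → TP2 K → TP2 L → TP2 (compose N K L)
  TP2-compose zero    tpK tpL v< j< = z≤n
  TP2-compose (suc N) {K} {L} tpK tpL {v₁} {v₂} {j₁} {j₂} v< j< = begin
    (a₁ * c₂ + S v₁ j₂) * (a₂ * c₁ + S v₂ j₁)
      ≡⟨ expand (a₁ * c₂) (S v₁ j₂) (a₂ * c₁) (S v₂ j₁) ⟩
    a₁ * c₂ * (a₂ * c₁) + (a₁ * c₂ * S v₂ j₁ + S v₁ j₂ * (a₂ * c₁)) + S v₁ j₂ * S v₂ j₁
      ≤⟨ +-mono-≤ (+-mono-≤ (≤-reflexive (corner a₁ a₂ c₁ c₂)) cross)
                  (TP2-compose N {K′} {L′} (λ w< t< → tpK w< (s≤s t<)) (λ t< → tpL (s≤s t<)) v< j<) ⟩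
    a₁ * c₁ * (a₂ * c₂) + (a₁ * c₁ * S v₂ j₂ + S v₁ j₁ * (a₂ * c₂)) + S v₁ j₁ * S v₂ j₂
      ≡⟨ expand (a₁ * c₁) (S v₁ j₁) (a₂ * c₂) (S v₂ j₂) ⟨
    (a₁ * c₁ + S v₁ j₁) * (a₂ * c₂ + S v₂ j₂) ∎
    where
    open ≤-Reasoning
    a₁ = K v₁ 0
    a₂ = K v₂ 0
    c₁ = L 0 j₁
    c₂ = L 0 j₂
    K′ L′ S : Kernel
    K′ v s = K v (suc s)
    L′ s j = L (suc s) j
    S = compose N K′ L′
    T : ℕ → ℕ → Vector ℕ N
    T v j s = K′ v (toℕ s) * L′ (toℕ s) j
    expand : ∀ x X y Y → (x + X) * (y + Y) ≡ x * y + (x * Y + X * y) + X * Y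
    expand = solve-∀
    corner : ∀ a₁ a₂ c₁ c₂ → a₁ * c₂ * (a₂ * c₁) ≡ a₁ * c₁ * (a₂ * c₂)
    corner = solve-∀
    -- Termwise in s, from the minors of K in columns 0 < s + 1 and of L in rows 0 < s + 1.
    cross : a₁ * c₂ * S v₂ j₁ + S v₁ j₂ * (a₂ * c₁) ≤ a₁ * c₁ * S v₂ j₂ + S v₁ j₁ * (a₂ * c₂)
    cross = subst₂ _≤_ (sym (x*∑f+∑g*y≡∑[xf+gy] (a₁ * c₂) (a₂ * c₁) (T v₂ j₁) (T v₁ j₂)))
                       (sym (x*∑f+∑g*y≡∑[xf+gy] (a₁ * c₁) (a₂ * c₂) (T v₂ j₂) (T v₁ j₁)))
      (∑-mono-≤ {N} λ s →
        minor-cross-term {a₁} {a₂} {c₁} {c₂} {K′ v₁ (toℕ s)} {K′ v₂ (toℕ s)} {L′ (toℕ s) j₁} {L′ (toℕ s) j₂}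
          (tpK v< (s≤s z≤n)) (tpL (s≤s z≤n) j<))

  window : ℕ → Kernel
  window b       (suc v) (suc w) = window b v w
  window b       (suc v) zero    = 0
  window zero    zero    w       = 0
  window (suc b) zero    zero    = 1
  window (suc b) zero    (suc w) = window b zero w

  window-≡1 : ∀ b v w → v ≤ w → w < v + b → window b v w ≡ 1
  window-≡1 (suc b) zero    zero    v≤w       w<v+b       = refl
  window-≡1 (suc b) zero    (suc w) v≤w       (s≤s w<v+b) = window-≡1 b zero w z≤n w<v+b
  window-≡1 b       (suc v) (suc w) (s≤s v≤w) (s≤s w<v+b) = window-≡1 b v w v≤w w<v+b

  window-≡0⊎inRange : ∀ b v w → window b v w ≡ 0 ⊎ (v ≤ w × w < v + b)
  window-≡0⊎inRange b       (suc v) (suc w) with window-≡0⊎inRange b v w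
  ... | inj₁ ≡0              = inj₁ ≡0
  ... | inj₂ (v≤w , w<v+b)   = inj₂ (s≤s v≤w , s≤s w<v+b)
  window-≡0⊎inRange b       (suc v) zero    = inj₁ refl
  window-≡0⊎inRange zero    zero    w       = inj₁ refl
  window-≡0⊎inRange (suc b) zero    zero    = inj₂ (z≤n , s≤s z≤n)
  window-≡0⊎inRange (suc b) zero    (suc w) with window-≡0⊎inRange b zero w
  ... | inj₁ ≡0              = inj₁ ≡0
  ... | inj₂ (_ , w<b)       = inj₂ (z≤n , s≤s w<b)

  window-TP2 : ∀ b → TP2 (window b)
  window-TP2 b {v₁} {v₂} {s} {t} v< s< with window-≡0⊎inRange b v₁ t | window-≡0⊎inRange b v₂ s
  ... | inj₁ ≡0 | _ rewrite ≡0 = z≤n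
  ... | inj₂ _ | inj₁ ≡0 rewrite ≡0 | *-zeroʳ (window b v₁ t) = z≤n
  ... | inj₂ (v₁≤t , t<v₁+b) | inj₂ (v₂≤s , s<v₂+b)
    rewrite window-≡1 b v₁ t v₁≤t t<v₁+b
          | window-≡1 b v₂ s v₂≤s s<v₂+b
          | window-≡1 b v₁ s (≤-trans (<⇒≤ v<) v₂≤s) (<-trans s< t<v₁+b)
          | window-≡1 b v₂ t (≤-trans v₂≤s (<⇒≤ s<)) (<-≤-trans t<v₁+b (+-monoˡ-≤ b (<⇒≤ v<)))
    = ≤-refl

  compose-window : ∀ b v N W → v + b ≤ N → ∀ j → compose N (window b) W v j ≡ ∑[ x < b ] W (v + toℕ x) j
  compose-window zero    zero    N       W v+b≤N       j = sum-replicate-zero N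
  compose-window (suc b) zero    (suc N) W (s≤s v+b≤N) j =
    cong₂ _+_ (+-identityʳ (W 0 j)) (compose-window b zero N (λ w → W (suc w)) v+b≤N j)
  compose-window b       (suc v) (suc N) W (s≤s v+b≤N) j = compose-window b v N (λ w → W (suc w)) v+b≤N j

  blockSum : ℕ → Kernel → Kernel
  blockSum b W v j = ∑[ x < b ] W (v + toℕ x) j

  blockSum-TP2 : ∀ b {W} → TP2 W → TP2 (blockSum b W)
  blockSum-TP2 b {W} tpW {v₁} {v₂} {j₁} {j₂} v< j< =
    subst₂ _≤_ (cong₂ _*_ (row₁ j₂) (row₂ j₁)) (cong₂ _*_ (row₁ j₁) (row₂ j₂))
      (TP2-compose (v₂ + b) {window b} {W} (window-TP2 b) tpW v< j<)
    where
    row₁ : ∀ j → compose (v₂ + b) (window b) W v₁ j ≡ blockSum b W v₁ j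
    row₂ : ∀ j → compose (v₂ + b) (window b) W v₂ j ≡ blockSum b W v₂ j
    row₁ = compose-window b v₁ (v₂ + b) W (+-monoˡ-≤ b (<⇒≤ v<))
    row₂ = compose-window b v₂ (v₂ + b) W ≤-refl

  sumOverTuples : ℕ → ℕ → (ℕ → ℕ) → ℕ
  sumOverTuples zero    b f = f 0
  sumOverTuples (suc n) b f = ∑[ x < b ] sumOverTuples n b (λ s → f (toℕ x + s))

  sumOverTuples-cong : ∀ n b {f g : ℕ → ℕ} → (∀ s → f s ≡ g s) → sumOverTuples n b f ≡ sumOverTuples n b g
  sumOverTuples-cong zero    b f≡g = f≡g 0
  sumOverTuples-cong (suc n) b f≡g = sum-cong-≗ {b} (λ x → sumOverTuples-cong n b (λ s → f≡g (toℕ x + s)))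

  sumOverTuples-∑ : ∀ n b {M} (f : Fin M → ℕ → ℕ) →
    sumOverTuples n b (λ s → ∑[ y < M ] f y s) ≡ ∑[ y < M ] sumOverTuples n b (f y)
  sumOverTuples-∑ zero    b f = refl
  sumOverTuples-∑ (suc n) b {M} f = trans
    (sum-cong-≗ {b} (λ x → sumOverTuples-∑ n b (λ y s → f y (toℕ x + s))))
    (∑-comm {b} {M} (λ x y → sumOverTuples n b (λ s → f y (toℕ x + s))))

  sumOverTuples-sucʳ : ∀ n b (f : ℕ → ℕ) →
    sumOverTuples (suc n) b f ≡ sumOverTuples n b (λ s → ∑[ x < b ] f (s + toℕ x))
  sumOverTuples-sucʳ n b f = begin
    ∑[ x < b ] sumOverTuples n b (λ s → f (toℕ x + s))
      ≡⟨ sum-cong-≗ {b} (λ x → sumOverTuples-cong n b (λ s → cong f (+-comm (toℕ x) s))) ⟩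
    ∑[ x < b ] sumOverTuples n b (λ s → f (s + toℕ x))
      ≡⟨ sumOverTuples-∑ n b {b} (λ x s → f (s + toℕ x)) ⟨
    sumOverTuples n b (λ s → ∑[ x < b ] f (s + toℕ x)) ∎
    where open ≡-Reasoning

  sumOverTuples-TP2 : ∀ n b {W} → TP2 W → TP2 (λ i j → sumOverTuples n b (λ s → W (i + s) j))
  sumOverTuples-TP2 zero    b {W} tpW = TP2-resp (λ i j → cong (λ k → W k j) (sym (+-identityʳ i))) tpW
  sumOverTuples-TP2 (suc n) b {W} tpW =
    TP2-resp peel (sumOverTuples-TP2 n b {blockSum b W} (blockSum-TP2 b {W} tpW))
    where
    peel : ∀ i j → sumOverTuples n b (λ s → blockSum b W (i + s) j) ≡ sumOverTuples (suc n) b (λ s → W (i + s) j)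
    peel i j = sym (trans (sumOverTuples-sucʳ n b (λ s → W (i + s) j))
      (sumOverTuples-cong n b λ s → sum-cong-≗ {b} λ x → cong (λ k → W k j) (sym (+-assoc i s (toℕ x)))))

  indicator : ∀ {ℓ} {A : Set ℓ} → Dec A → ℕ
  indicator (yes _) = 1
  indicator (no _)  = 0

  length-filter-∷ : ∀ {a p} {A : Set a} {P : Pred A p} (P? : Decidable P) x xs →
    length (filter P? (x ∷ xs)) ≡ indicator (P? x) + length (filter P? xs)
  length-filter-∷ P? x xs with P? x
  ... | yes _ = refl
  ... | no _  = refl

  length-filter-map : ∀ {a b p} {A : Set a} {B : Set b} {P : Pred B p} (P? : Decidable P) (f : A → B) xs →
    length (filter P? (map f xs)) ≡ length (filter (P? ∘ f) xs)
  length-filter-map P? f []       = refl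
  length-filter-map P? f (x ∷ xs) = begin
    length (filter P? (f x ∷ map f xs))                  ≡⟨ length-filter-∷ P? (f x) (map f xs) ⟩
    indicator (P? (f x)) + length (filter P? (map f xs))   ≡⟨ cong (indicator (P? (f x)) +_) (length-filter-map P? f xs) ⟩
    indicator (P? (f x)) + length (filter (P? ∘ f) xs)     ≡⟨ length-filter-∷ (P? ∘ f) x xs ⟨
    length (filter (P? ∘ f) (x ∷ xs))                    ∎
    where open ≡-Reasoning

  length-filter-concatMap-tabulate : ∀ {a b p} {A : Set a} {B : Set b} {P : Pred B p} (P? : Decidable P)
    {M} (h : A → List B) (g : Fin M → A) →
    length (filter P? (concatMap h (tabulate g))) ≡ ∑[ x < M ] length (filter P? (h (g x)))
  length-filter-concatMap-tabulate P? {zero}  h g = refl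
  length-filter-concatMap-tabulate P? {suc M} h g = begin
    length (filter P? (h (g Fin.zero) ++ rest))               ≡⟨ cong length (filter-++ P? (h (g Fin.zero)) rest) ⟩
    length (filter P? (h (g Fin.zero)) ++ filter P? rest)     ≡⟨ length-++ (filter P? (h (g Fin.zero))) ⟩
    length (filter P? (h (g Fin.zero))) + length (filter P? rest)
      ≡⟨ cong (length (filter P? (h (g Fin.zero))) +_) (length-filter-concatMap-tabulate P? h (g ∘ Fin.suc)) ⟩
    ∑[ x < suc M ] length (filter P? (h (g x)))               ∎
    where
    open ≡-Reasoning
    rest = concatMap h (tabulate (g ∘ Fin.suc))

  length-filter-allTuples : ∀ n b {ℓ} {R : ℕ → Set ℓ} (R? : ∀ s → Dec (R s)) →
    length (filter (R? ∘ digitSum) (allTuples n b)) ≡ sumOverTuples n b (indicator ∘ R?)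
  length-filter-allTuples zero    b R? = trans (length-filter-∷ (R? ∘ digitSum) Vec.[] []) (+-identityʳ _)
  length-filter-allTuples (suc n) b R? = begin
    length (filter (R? ∘ digitSum) (concatMap (λ x → map (x Vec.∷_) (allTuples n b)) (allFin b)))
      ≡⟨ length-filter-concatMap-tabulate (R? ∘ digitSum) (λ x → map (x Vec.∷_) (allTuples n b)) id ⟩
    ∑[ x < b ] length (filter (R? ∘ digitSum) (map (x Vec.∷_) (allTuples n b)))
      ≡⟨ sum-cong-≗ {b} (λ x → trans (length-filter-map (R? ∘ digitSum) (x Vec.∷_) (allTuples n b))
                                      (length-filter-allTuples n b (λ s → R? (toℕ x + s)))) ⟩
    ∑[ x < b ] sumOverTuples n b (λ s → indicator (R? (toℕ x + s))) ∎
    where open ≡-Reasoning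

  carryIndicator : ℕ → Kernel
  carryIndicator b v j = indicator ((j * b ≤? v) ×-dec (v ≤? suc j * b ∸ 1))

  carryIndicator-TP2 : ∀ b → TP2 (carryIndicator b)
  carryIndicator-TP2 b {v₁} {v₂} {j₁} {j₂} v₁<v₂ j₁<j₂
    with (j₂ * b ≤? v₁) ×-dec (v₁ ≤? suc j₂ * b ∸ 1) | (j₁ * b ≤? v₂) ×-dec (v₂ ≤? suc j₁ * b ∸ 1)
  ... | no _ | _    = z≤n
  ... | yes _ | no _ = z≤n
  ... | yes (j₂b≤v₁ , _) | yes (_ , v₂≤[1+j₁]b-1) = ⊥-elim (<-irrefl refl (begin-strict
    v₁               <⟨ v₁<v₂ ⟩
    v₂               ≤⟨ v₂≤[1+j₁]b-1 ⟩
    suc j₁ * b ∸ 1   ≤⟨ m∸n≤m (suc j₁ * b) 1 ⟩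
    suc j₁ * b       ≤⟨ *-monoˡ-≤ b j₁<j₂ ⟩
    j₂ * b           ≤⟨ j₂b≤v₁ ⟩
    v₁               ∎))
    where open ≤-Reasoning

  carryCount-TP2 : ∀ n b → TP2 (carryCount n b)
  carryCount-TP2 n b = TP2-resp (λ i j → sym (carryCount≡sumOverTuples i j))
    (sumOverTuples-TP2 n b {carryIndicator b} (carryIndicator-TP2 b))
    where
    carryCount≡sumOverTuples : ∀ i j → carryCount n b i j ≡ sumOverTuples n b (λ s → carryIndicator b (i + s) j)
    carryCount≡sumOverTuples i j =
      length-filter-allTuples n b (λ s → (j * b ≤? i + s) ×-dec (i + s ≤? suc j * b ∸ 1))

open Kernels using (carryCount-TP2)

open import Data.Nat as ℕ using (ℕ; suc; _≤_; NonZero; _^_)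
open import Data.Nat.Properties using (m^n≢0)
open import Data.Fin using (Fin; _<_; toℕ)
open import Data.Integer as ℤ using (+_)
import Data.Integer.Properties as ℤ
open import Data.Rational using (ℚ; 0ℚ; _*_; _-_) renaming (_≤_ to _≤ℚ_)
open import Data.Rational using (_/_; -_; toℚᵘ)
open import Data.Rational.Properties using (+-inverseʳ; +-monoˡ-≤; toℚᵘ-homo-*; toℚᵘ-fromℚᵘ; toℚᵘ-cancel-≤)
open import Data.Rational.Unnormalised as ℚᵘ using (ℚᵘ; mkℚᵘ; *≤*)
import Data.Rational.Unnormalised.Properties as ℚᵘ
open import Relation.Binary.PropositionalEquality using (subst; subst₂)

p≤q⇒0≤q-p : ∀ {p q} → p ≤ℚ q → 0ℚ ≤ℚ q - p
p≤q⇒0≤q-p {p} {q} p≤q = subst (_≤ℚ q - p) (+-inverseʳ p) (+-monoˡ-≤ (- p) p≤q)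

/-*-/-mono-≤ : ∀ {a c e f} d .{{_ : NonZero d}} → e ℕ.* f ≤ a ℕ.* c →
  (+ e / d) * (+ f / d) ≤ℚ (+ a / d) * (+ c / d)
/-*-/-mono-≤ {a} {c} {e} {f} (suc d) ef≤ac =
  toℚᵘ-cancel-≤ (ℚᵘ.≤-respˡ-≃ (ℚᵘ.≃-sym (unnormalise e f)) (ℚᵘ.≤-respʳ-≃ (ℚᵘ.≃-sym (unnormalise a c))
    (*≤* (ℤ.*-monoʳ-≤-nonNeg (+ (suc d ℕ.* suc d)) (subst₂ ℤ._≤_ (ℤ.pos-* e f) (ℤ.pos-* a c) (ℤ.+≤+ ef≤ac))))))
  where
  over : ℕ → ℚᵘ
  over x = mkℚᵘ (+ x) d
  unnormalise : ∀ x y → toℚᵘ ((+ x / suc d) * (+ y / suc d)) ℚᵘ.≃ over x ℚᵘ.* over y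
  unnormalise x y = ℚᵘ.≃-trans (toℚᵘ-homo-* (+ x / suc d) (+ y / suc d))
    (ℚᵘ.*-cong (toℚᵘ-fromℚᵘ (over x)) (toℚᵘ-fromℚᵘ (over y)))

lemma4p2 : (n b : ℕ) .{{_ : NonZero b}} → 1 ≤ n → 2 ≤ b →
    (i₁ i₂ j₁ j₂ : Fin n) → i₁ < i₂ → j₁ < j₂ →
    0ℚ ≤ℚ (P n b i₁ j₁ * P n b i₂ j₂ - P n b i₁ j₂ * P n b i₂ j₁)
lemma4p2 n b _ _ i₁ i₂ j₁ j₂ i₁<i₂ j₁<j₂ =
  p≤q⇒0≤q-p (/-*-/-mono-≤ {C i₁ j₁} {C i₂ j₂} {C i₁ j₂} {C i₂ j₁} (b ^ n) {{m^n≢0 b n}}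
                            (carryCount-TP2 n b i₁<i₂ j₁<j₂))
  where
  C : Fin n → Fin n → ℕ
  C i j = carryCount n b (toℕ i) (toℕ j)
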